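{- Let $(S,\mathcal{U})$ be a composable map with unique cores. Then for all $U_1,U_2\subseteq\mathcal{U}$, $\mathrm{core}(S(U_1\cup U_2))\subseteq\mathrm{core}(S(U_1))\cup\mathrm{core}(S(U_2))$.
   Context: Composable map: finite $\mathcal{U}$, $S:2^{\mathcal{U}}\to\Sigma$, binary operation $\oplus$ with $S(U\cup V)=S(U)\oplus S(V)$. A core of $\sigma$ is an inclusion-minimal set with sketch $\sigma$; unique cores means each sketch $\sigma$ has exactly one core, denoted $\mathrm{core}(\sigma)$. -}

module Defs where

open import Data.Nat using (ℕ)
open import Data.Fin.Subset using (Subset; _⊆_; _∪_)
open import Data.Product using (_×_)
open import Relation.Binary.PropositionalEquality using (_≡_)
open import Relation.Nullary using (¬_)

IsComposable : {n : ℕ} {Σ : Set} → (Subset n → Σ) → (Σ → Σ → Σ) → Set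
IsComposable {n} S _⊕_ = (U V : Subset n) → S (U ∪ V) ≡ (S U ⊕ S V)

IsCore : {n : ℕ} {Σ : Set} → (Subset n → Σ) → Σ → Subset n → Set
IsCore {n} S σ C = (S C ≡ σ) × ((D : Subset n) → D ⊆ C → S D ≡ σ → C ⊆ D)

-- Unique cores: every sketch σ = S U (i.e. every sketch realised by some
-- subset; unrealised sketches have no core at all) has exactly one core
-- (at least one, and any two cores coincide).
open import Data.Product using (∃)
UniqueCores : {n : ℕ} {Σ : Set} → (Subset n → Σ) → Set
UniqueCores {n} {Σ} S = (U : Subset n) → let σ = S U in ∃ (IsCore S σ) × ((C C′ : Subset n) → IsCore S σ C → IsCore S σ C′ → C ≡ C′)

{-# OPTIONS --safe #-}
module Submission where

open import Defs
open import Data.Nat using (ℕ)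
open import Data.Fin.Subset using (Subset; _⊆_; _⊂_; _∪_; _∈_)
open import Data.Fin.Subset.Properties using (_∈?_)
open import Data.Fin.Subset.Induction using (Acc; acc; ⊂-wellFounded)
open import Data.Product using (_,_; proj₁; proj₂)
open import Relation.Nullary using (yes; no; contradiction)
open import Relation.Binary.PropositionalEquality using (_≡_; cong₂; subst; module ≡-Reasoning)

module _ {n : ℕ} {Σ : Set} (S : Subset n → Σ) {σ : Σ} {C : Subset n}
         (sole-core : ∀ {D} → IsCore S σ D → C ≡ D) where

  -- If some x ∈ C lay outside X, then by induction every proper subset of X
  -- with sketch σ would contain x, so none exists: X would be a core, i.e. X ≡ C ∋ x.
  private
    sole-core-⊆-acc : ∀ {X} → Acc _⊂_ X → S X ≡ σ → C ⊆ X
    sole-core-⊆-acc {X} (acc rec) SX≡σ {x} x∈C with x ∈? X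
    ... | yes x∈X = x∈X
    ... | no x∉X = contradiction (subst (x ∈_) (sole-core (SX≡σ , minimal)) x∈C) x∉X
      where
      minimal : ∀ D → D ⊆ X → S D ≡ σ → X ⊆ D
      minimal D D⊆X SD≡σ {y} y∈X with y ∈? D
      ... | yes y∈D = y∈D
      ... | no y∉D =
        contradiction (D⊆X (sole-core-⊆-acc (rec (D⊆X , y , y∈X , y∉D)) SD≡σ x∈C)) x∉X

  sole-core-⊆ : ∀ X → S X ≡ σ → C ⊆ X
  sole-core-⊆ X = sole-core-⊆-acc (⊂-wellFounded X)

sketch-∪-cong : {n : ℕ} {Σ : Set} (S : Subset n → Σ) (_⊕_ : Σ → Σ → Σ) →
  IsComposable S _⊕_ → {U₁ U₂ V₁ V₂ : Subset n} →
  S U₁ ≡ S V₁ → S U₂ ≡ S V₂ → S (U₁ ∪ U₂) ≡ S (V₁ ∪ V₂)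
sketch-∪-cong S _⊕_ composable {U₁} {U₂} {V₁} {V₂} eq₁ eq₂ = begin
  S (U₁ ∪ U₂)   ≡⟨ composable U₁ U₂ ⟩
  S U₁ ⊕ S U₂   ≡⟨ cong₂ _⊕_ eq₁ eq₂ ⟩
  S V₁ ⊕ S V₂   ≡⟨ composable V₁ V₂ ⟨
  S (V₁ ∪ V₂)   ∎
  where open ≡-Reasoning

mainTheorem15 : {n : ℕ} {Σ : Set} (S : Subset n → Σ) (_⊕_ : Σ → Σ → Σ) →
    IsComposable S _⊕_ → UniqueCores S →
    (U₁ U₂ C C₁ C₂ : Subset n) →
    IsCore S (S (U₁ ∪ U₂)) C → IsCore S (S U₁) C₁ → IsCore S (S U₂) C₂ →
    C ⊆ (C₁ ∪ C₂)
mainTheorem15 S _⊕_ composable unique U₁ U₂ C C₁ C₂ C-core C₁-core C₂-core =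
  sole-core-⊆ S sole-core (C₁ ∪ C₂) C₁∪C₂-sketch
  where
  sole-core : ∀ {D} → IsCore S (S (U₁ ∪ U₂)) D → C ≡ D
  sole-core = proj₂ (unique (U₁ ∪ U₂)) C _ C-core

  C₁∪C₂-sketch : S (C₁ ∪ C₂) ≡ S (U₁ ∪ U₂)
  C₁∪C₂-sketch = sketch-∪-cong S _⊕_ composable (proj₁ C₁-core) (proj₁ C₂-core)
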